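{- Let $d \ge 2$ and $n > d$ be integers such that $\lfloor d/2 \rfloor$ divides $n$ if $d$ is even, and divides $n-1$ if $d$ is odd. Let $P^*(n,d)$ be the polytope constructed below and let $c^*(n,d)$ be the dual cyclic polytope. Then \[ f_0(c^*(n,d)) \le O\!\left(e^{\lfloor d/2 \rfloor}\right) \cdot f_0(P^*(n,d)), \] where the implicit constant in the $O(\cdot)$ is independent of $n$ and $d$.
   Context: For a polytope $P$, $f_k(P)$ denotes the number of $k$-dimensional faces of $P$. $LI(2)$ is the family of linear inequality systems $Ax \le b$ ($A \in \mathbb{R}^{n\times d}$, $b\in\mathbb{R}^n$) in which every inequality has at most two variables with nonzero coefficient. The dual cyclic polytope $c^*(n,d)$ is the polar of the $d$-dimensional cyclic polytope with $n$ vertices; it is a $d$-polytope given by $n$ constraints, with $f_0(c^*(n,d)) = \binom{n-\lceil d/2\rceil}{n-d} + \binom{n-\lfloor d/2\rfloor-1}{n-d}$. Construction of $P^*(n,d)$: if $d$ is even, for each $1 \le i \le d/2$ let $P_i^* = \{(x_{2i-1},x_{2i}) : A_i (x_{2i-1},x_{2i})^T \le b_i\}$ be a polygon in the $(x_{2i-1},x_{2i})$-plane given by $n/(d/2)$ constraints and having $n/(d/2)$ vertices, and set $P^*(n,d) = \{x\in\mathbb{R}^d : (x_{2i-1},x_{2i}) \in P_i^* \text{ for all } 1\le i\le d/2\}$, defined by the union of all these $n$ constraints (so it lies in $LI(2)$). If $d$ is odd, set $P^*(n,d) = \{x \in \mathbb{R}^d : (x_1,\dots,x_{d-1}) \in P^*(n-1,d-1),\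 x_d \ge 0\}$. By a result of Amenta and Ziegler, $f_0(P^*(n,d)) = (n/(d/2))^{d/2}$ for $d$ even and $((n-1)/\lfloor d/2\rfloor)^{\lfloor d/2\rfloor}$ for $d$ odd. -}

module Defs where

open import Data.Nat as ℕ using (ℕ; zero; suc; _∸_; ⌊_/2⌋; ⌈_/2⌉; _%_)
open import Data.Nat.Properties using (_!≢0)
open import Data.Nat.DivMod using (_/_)
open import Data.Nat.Combinatorics using (_C_)
open import Data.Integer using (+_)
open import Data.Rational as ℚ using (ℚ; 0ℚ; 1ℚ; _≤_)

ℕ→ℚ : ℕ → ℚ
ℕ→ℚ m = (+ m) ℚ./ 1

_^ℚ_ : ℚ → ℕ → ℚ
q ^ℚ zero = 1ℚ
q ^ℚ suc k = q ℚ.* (q ^ℚ k)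

ePartial : ℕ → ℚ
ePartial zero = 1ℚ
ePartial (suc N) = ePartial N ℚ.+ ((+ 1) ℚ./ (suc N ℕ.!)) {{suc N !≢0}}

-- q is an upper bound for e = sup_N Σ_{j≤N} 1/j!, i.e. e ≤ q
eLe : ℚ → Set
eLe q = ∀ N → ePartial N ≤ q

f0-cyclicDual : ℕ → ℕ → ℕ
f0-cyclicDual n d = ((n ∸ ⌈ d /2⌉) C (n ∸ d)) ℕ.+ ((n ∸ ⌊ d /2⌋ ∸ 1) C (n ∸ d))

-- the number that ⌊d/2⌋ must divide: n if d even, n-1 if d odd
nEff : ℕ → ℕ → ℕ
nEff n d = n ∸ (d % 2)

-- f_0 of P*(n,d) (Amenta–Ziegler): (n'/⌊d/2⌋)^⌊d/2⌋ with n' = nEff n d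
f0-Pstar : ℕ → ℕ → ℕ
f0-Pstar n d with ⌊ d /2⌋
... | zero = 0
... | suc j = (nEff n d / suc j) ℕ.^ suc j

-- Write k = ⌊d/2⌋ and let n′ = n or n − 1 according to the parity of d. Of the two
-- binomial coefficients in f₀(c*(n,d)), the first equals C(m, k) with m = n − ⌈d/2⌉ ≤ n′
-- and the second is no larger, so f₀(c*(n,d)) · k! ≤ 2 C(m, k) k! ≤ 2 n′ᵏ. Writing
-- n′ = t k gives n′ᵏ = tᵏ kᵏ with tᵏ = f₀(P*(n,d)), and kᵏ ≤ k! eᵏ follows by induction
-- from (1 + k)ᵏ ≤ e kᵏ, which is the binomial theorem together with C(k, i) kᵏ⁻ⁱ ≤ kᵏ / i!.
module Submission where

open import Defs

module Binomial where

  open import Data.Nat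
    using (zero; suc; _+_; _*_; _^_; _∸_; _!; _≤_; z≤n; _≤′_; ≤′-refl; ≤′-step; _≤ᵇ_; _≤?_)
  open import Data.Nat.Properties
  open import Data.Nat.DivMod using (_/_; m/n*n≤m)
  open import Data.Nat.Combinatorics
    using (_C_; _P_; nCk≡nPk/k!; nCk≡nC[n∸k]; nCk+nC[k+1]≡[n+1]C[k+1])
  open import Data.Nat.Combinatorics.Base using (_P′_)
  open import Data.Nat.Combinatorics.Specification using (k>n⇒nCk≡0)
  open import Data.Fin using (toℕ)
  open import Algebra.Properties.Monoid.Sum +-0-monoid using (sum-cong-≗; sum⁺-syntax)
  import Algebra.Properties.CommutativeSemiring.Binomial +-*-commutativeSemiring as BinomialTheorem
  import Algebra.Properties.Semiring.Exp +-*-semiring as SemiringExp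
  import Algebra.Properties.Semiring.Mult +-*-semiring as SemiringMult
  open import Data.Bool using (true; false)
  open import Relation.Nullary using (yes; no)
  open import Relation.Binary.PropositionalEquality

  nP′k≤n^k : ∀ n k → n P′ k ≤ n ^ k
  nP′k≤n^k n zero    = ≤-refl
  nP′k≤n^k n (suc k) = *-mono-≤ (m∸n≤m n k) (nP′k≤n^k n k)

  nPk≤n^k : ∀ n k → n P k ≤ n ^ k
  nPk≤n^k n k with k ≤ᵇ n
  ... | true  = nP′k≤n^k n k
  ... | false = z≤n

  nCk*k!≤n^k : ∀ n k → (n C k) * k ! ≤ n ^ k
  nCk*k!≤n^k n k with k ≤? n
  ... | no k≰n rewrite k>n⇒nCk≡0 (≰⇒> k≰n) = z≤n
  ... | yes k≤n = begin
    (n C k) * k !                   ≡⟨ cong (_* k !) (nCk≡nPk/k! k≤n) ⟩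
    ((n P k) / k !) {{k !≢0}} * k ! ≤⟨ m/n*n≤m (n P k) (k !) {{k !≢0}} ⟩
    n P k                           ≤⟨ nPk≤n^k n k ⟩
    n ^ k                           ∎
    where open ≤-Reasoning

  nCk≤[1+n]Ck : ∀ n k → n C k ≤ suc n C k
  nCk≤[1+n]Ck n zero    = ≤-refl
  nCk≤[1+n]Ck n (suc k) = subst (n C suc k ≤_) (nCk+nC[k+1]≡[n+1]C[k+1] n k) (m≤n+m _ _)

  C-monoˡ-≤ : ∀ {m n} k → m ≤ n → m C k ≤ n C k
  C-monoˡ-≤ k m≤n = go (≤⇒≤′ m≤n)
    where
    go : ∀ {m n} → m ≤′ n → m C k ≤ n C k
    go ≤′-refl           = ≤-refl
    go (≤′-step {n} m≤n) = ≤-trans (go m≤n) (nCk≤[1+n]Ck n k)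

  [m+n]Cm≡[m+n]Cn : ∀ m n → (m + n) C m ≡ (m + n) C n
  [m+n]Cm≡[m+n]Cn m n = trans (nCk≡nC[n∸k] (m≤m+n m n)) (cong ((m + n) C_) (m+n∸m≡n m n))

  nCi*n^[n∸i]*i!≤n^n : ∀ n i → (n C i) * n ^ (n ∸ i) * i ! ≤ n ^ n
  nCi*n^[n∸i]*i!≤n^n n i with i ≤? n
  ... | no i≰n rewrite k>n⇒nCk≡0 (≰⇒> i≰n) = z≤n
  ... | yes i≤n = begin
    (n C i) * n ^ (n ∸ i) * i !   ≡⟨ *-assoc (n C i) _ _ ⟩
    (n C i) * (n ^ (n ∸ i) * i !) ≡⟨ cong ((n C i) *_) (*-comm (n ^ (n ∸ i)) (i !)) ⟩
    (n C i) * (i ! * n ^ (n ∸ i)) ≡⟨ *-assoc (n C i) _ _ ⟨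
    (n C i) * i ! * n ^ (n ∸ i)   ≤⟨ *-monoˡ-≤ (n ^ (n ∸ i)) (nCk*k!≤n^k n i) ⟩
    n ^ i * n ^ (n ∸ i)           ≡⟨ ^-distribˡ-+-* n i (n ∸ i) ⟨
    n ^ (i + (n ∸ i))             ≡⟨ cong (n ^_) (m+[n∸m]≡n i≤n) ⟩
    n ^ n                         ∎
    where open ≤-Reasoning

  ^-distribʳ-* : ∀ m n k → (m * n) ^ k ≡ m ^ k * n ^ k
  ^-distribʳ-* m n zero    = refl
  ^-distribʳ-* m n (suc k) =
    trans (cong (m * n *_) (^-distribʳ-* m n k)) ([m*n]*[o*p]≡[m*o]*[n*p] m n (m ^ k) (n ^ k))

  ×≡* : ∀ m n → m SemiringMult.× n ≡ m * n
  ×≡* zero    n = refl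
  ×≡* (suc m) n = cong (n +_) (×≡* m n)

  ^≡^ : ∀ m n → m SemiringExp.^ n ≡ m ^ n
  ^≡^ m zero    = refl
  ^≡^ m (suc n) = cong (m *_) (^≡^ m n)

  [1+k]^n≡∑nCi*k^[n∸i] : ∀ k n → (1 + k) ^ n ≡ ∑[ i ≤ n ] ((n C toℕ i) * k ^ (n ∸ toℕ i))
  [1+k]^n≡∑nCi*k^[n∸i] k n = begin
    (1 + k) ^ n                                 ≡⟨ ^≡^ (1 + k) n ⟨
    (1 + k) SemiringExp.^ n                     ≡⟨ BinomialTheorem.theorem n 1 k ⟩
    BinomialTheorem.binomialExpansion 1 k n     ≡⟨ sum-cong-≗ {suc n} term ⟩
    ∑[ i ≤ n ] ((n C toℕ i) * k ^ (n ∸ toℕ i)) ∎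
    where
    open ≡-Reasoning
    term : ∀ i → (n C toℕ i) SemiringMult.× ((1 SemiringExp.^ toℕ i) * (k SemiringExp.^ (n ∸ toℕ i)))
               ≡ (n C toℕ i) * k ^ (n ∸ toℕ i)
    term i rewrite ×≡* (n C toℕ i) ((1 SemiringExp.^ toℕ i) * (k SemiringExp.^ (n ∸ toℕ i)))
                 | ^≡^ 1 (toℕ i) | ^≡^ k (n ∸ toℕ i) | ^-zeroˡ (toℕ i) =
      cong ((n C toℕ i) *_) (*-identityˡ _)

module CyclicPolytope where

  open import Data.Nat
    using (ℕ; zero; suc; _+_; _*_; _^_; _∸_; _!; _≤_; z≤n; s≤s; ⌊_/2⌋; ⌈_/2⌉; _%_)
  open import Data.Nat.Properties
  open import Data.Nat.DivMod using (m%n<n; m*n/n≡m)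
  open import Data.Nat.Combinatorics using (_C_)
  open import Relation.Binary.PropositionalEquality
  open Binomial using (nCk*k!≤n^k; C-monoˡ-≤; [m+n]Cm≡[m+n]Cn)

  ⌈n/2⌉≤1+⌊n/2⌋ : ∀ n → ⌈ n /2⌉ ≤ suc ⌊ n /2⌋
  ⌈n/2⌉≤1+⌊n/2⌋ zero          = z≤n
  ⌈n/2⌉≤1+⌊n/2⌋ (suc zero)    = ≤-refl
  ⌈n/2⌉≤1+⌊n/2⌋ (suc (suc n)) = s≤s (⌈n/2⌉≤1+⌊n/2⌋ n)

  n∸⌈d/2⌉≡n∸d+⌊d/2⌋ : ∀ {n d} → d ≤ n → n ∸ ⌈ d /2⌉ ≡ n ∸ d + ⌊ d /2⌋
  n∸⌈d/2⌉≡n∸d+⌊d/2⌋ {n} {d} d≤n = begin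
    n ∸ c               ≡⟨ cong (_∸ c) (m∸n+n≡m d≤n) ⟨
    n ∸ d + d ∸ c       ≡⟨ cong (λ x → n ∸ d + x ∸ c) (⌊n/2⌋+⌈n/2⌉≡n d) ⟨
    n ∸ d + (f + c) ∸ c ≡⟨ cong (_∸ c) (+-assoc (n ∸ d) f c) ⟨
    n ∸ d + f + c ∸ c   ≡⟨ m+n∸n≡m (n ∸ d + f) c ⟩
    n ∸ d + f           ∎
    where
    open ≡-Reasoning
    f c : ℕ
    f = ⌊ d /2⌋
    c = ⌈ d /2⌉

  f0-cyclicDual≤2*[n∸⌈d/2⌉]C⌊d/2⌋ : ∀ {n d} → d ≤ n →
    f0-cyclicDual n d ≤ 2 * ((n ∸ ⌈ d /2⌉) C ⌊ d /2⌋)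
  f0-cyclicDual≤2*[n∸⌈d/2⌉]C⌊d/2⌋ {n} {d} d≤n = begin
    (n ∸ c) C (n ∸ d) + (n ∸ f ∸ 1) C (n ∸ d) ≤⟨ +-monoʳ-≤ _ (C-monoˡ-≤ (n ∸ d) n∸f∸1≤n∸c) ⟩
    (n ∸ c) C (n ∸ d) + (n ∸ c) C (n ∸ d)     ≡⟨ cong (λ x → x + x) first-term ⟩
    (n ∸ c) C f + (n ∸ c) C f                 ≡⟨ cong ((n ∸ c) C f +_) (+-identityʳ _) ⟨
    2 * ((n ∸ c) C f)                         ∎
    where
    open ≤-Reasoning
    f c : ℕ
    f = ⌊ d /2⌋
    c = ⌈ d /2⌉
    n∸f∸1≤n∸c : n ∸ f ∸ 1 ≤ n ∸ c
    n∸f∸1≤n∸c = begin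
      n ∸ f ∸ 1   ≡⟨ ∸-+-assoc n f 1 ⟩
      n ∸ (f + 1) ≤⟨ ∸-monoʳ-≤ n (subst (c ≤_) (+-comm 1 f) (⌈n/2⌉≤1+⌊n/2⌋ d)) ⟩
      n ∸ c       ∎
    first-term : (n ∸ c) C (n ∸ d) ≡ (n ∸ c) C f
    first-term rewrite n∸⌈d/2⌉≡n∸d+⌊d/2⌋ d≤n = [m+n]Cm≡[m+n]Cn (n ∸ d) f

  n∸⌈d/2⌉≤nEff : ∀ n {d} → 1 ≤ d → n ∸ ⌈ d /2⌉ ≤ nEff n d
  n∸⌈d/2⌉≤nEff n {d} 1≤d = ∸-monoʳ-≤ n (≤-trans (≤-pred (m%n<n d 2)) (⌈n/2⌉-mono 1≤d))

  f0-cyclicDual*⌊d/2⌋!≤2*nEff^⌊d/2⌋ : ∀ {n d} → 1 ≤ d → d ≤ n →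
    f0-cyclicDual n d * ⌊ d /2⌋ ! ≤ 2 * nEff n d ^ ⌊ d /2⌋
  f0-cyclicDual*⌊d/2⌋!≤2*nEff^⌊d/2⌋ {n} {d} 1≤d d≤n = begin
    f0-cyclicDual n d * f ! ≤⟨ *-monoˡ-≤ (f !) (f0-cyclicDual≤2*[n∸⌈d/2⌉]C⌊d/2⌋ d≤n) ⟩
    2 * (m C f) * f !       ≡⟨ *-assoc 2 (m C f) (f !) ⟩
    2 * ((m C f) * f !)     ≤⟨ *-monoʳ-≤ 2 (nCk*k!≤n^k m f) ⟩
    2 * m ^ f               ≤⟨ *-monoʳ-≤ 2 (^-monoˡ-≤ f (n∸⌈d/2⌉≤nEff n 1≤d)) ⟩
    2 * nEff n d ^ f        ∎
    where
    open ≤-Reasoning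
    f m : ℕ
    f = ⌊ d /2⌋
    m = n ∸ ⌈ d /2⌉

  f0-Pstar≡t^⌊d/2⌋ : ∀ n d t → 1 ≤ ⌊ d /2⌋ → nEff n d ≡ t * ⌊ d /2⌋ → f0-Pstar n d ≡ t ^ ⌊ d /2⌋
  f0-Pstar≡t^⌊d/2⌋ n d t 1≤⌊d/2⌋ nEff≡t*⌊d/2⌋ with ⌊ d /2⌋
  ... | suc k rewrite nEff≡t*⌊d/2⌋ = cong (_^ suc k) (m*n/n≡m t (suc k))

module EulerBound where

  open import Data.Nat as ℕ using (ℕ; zero; suc; _!; NonZero)
  open import Data.Nat.Properties as ℕₚ using (_!≢0)
  open import Data.Nat.Coprimality as Coprimality using (1-coprimeTo)
  open import Data.Integer as ℤ using (+_)
  import Data.Integer.Properties as ℤ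
  open import Data.Rational using (ℚ; mkℚ; _≤_; *≤*; _*_; _+_; _/_; 1ℚ; NonNegative; nonNegative)
  open import Data.Rational.Properties
  open import Data.Rational.Solver using (module +-*-Solver)
  open +-*-Solver using (solve; _:*_; _:=_)
  import Data.Fin as Fin
  open Fin using (toℕ; fromℕ; inject₁)
  open import Data.Fin.Properties using (toℕ-fromℕ; toℕ-inject₁)
  open import Data.Vec.Functional using (Vector; init; last)
  open import Algebra.Properties.Monoid.Sum ℕₚ.+-0-monoid using (sum; sum-init-last)
  open import Data.Nat.Combinatorics using (_C_)
  open import Function using (_∘_)
  open import Relation.Binary.PropositionalEquality
  open Binomial using (nCi*n^[n∸i]*i!≤n^n; [1+k]^n≡∑nCi*k^[n∸i]; ^-distribʳ-*)

  ℕ→ℚ≡mkℚ : ∀ m → ℕ→ℚ m ≡ mkℚ (+ m) 0 (Coprimality.sym (1-coprimeTo m))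
  ℕ→ℚ≡mkℚ m = normalize-coprime (Coprimality.sym (1-coprimeTo m))

  ℕ→ℚ-homo-+ : ∀ m n → ℕ→ℚ (m ℕ.+ n) ≡ ℕ→ℚ m + ℕ→ℚ n
  ℕ→ℚ-homo-+ m n rewrite ℕ→ℚ≡mkℚ m | ℕ→ℚ≡mkℚ n =
    cong (_/ 1) (sym (cong₂ ℤ._+_ (ℤ.*-identityʳ (+ m)) (ℤ.*-identityʳ (+ n))))

  ℕ→ℚ-homo-* : ∀ m n → ℕ→ℚ (m ℕ.* n) ≡ ℕ→ℚ m * ℕ→ℚ n
  ℕ→ℚ-homo-* m n rewrite ℕ→ℚ≡mkℚ m | ℕ→ℚ≡mkℚ n = cong (_/ 1) (ℤ.pos-* m n)

  ℕ→ℚ-mono-≤ : ∀ {m n} → m ℕ.≤ n → ℕ→ℚ m ≤ ℕ→ℚ n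
  ℕ→ℚ-mono-≤ {m} {n} m≤n rewrite ℕ→ℚ≡mkℚ m | ℕ→ℚ≡mkℚ n =
    *≤* (subst₂ ℤ._≤_ (sym (ℤ.*-identityʳ (+ m))) (sym (ℤ.*-identityʳ (+ n))) (ℤ.+≤+ m≤n))

  ℕ→ℚ-nonNeg : ∀ m → NonNegative (ℕ→ℚ m)
  ℕ→ℚ-nonNeg m = normalize-nonNeg m 1

  1/n*n≡1 : ∀ n .{{_ : NonZero n}} → ((+ 1) / n) * ℕ→ℚ n ≡ 1ℚ
  1/n*n≡1 (suc n) rewrite ℕ→ℚ≡mkℚ (suc n) | normalize-coprime {1} {n} (1-coprimeTo (suc n)) =
    *-inverseˡ (mkℚ (+ suc n) 0 (Coprimality.sym (1-coprimeTo (suc n))))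

  m*n≤o⇒m≤1/n*o : ∀ {m o} n .{{_ : NonZero n}} → m ℕ.* n ℕ.≤ o → ℕ→ℚ m ≤ ((+ 1) / n) * ℕ→ℚ o
  m*n≤o⇒m≤1/n*o {m} {o} n m*n≤o = begin
    ℕ→ℚ m                 ≡⟨ *-identityˡ (ℕ→ℚ m) ⟨
    1ℚ * ℕ→ℚ m            ≡⟨ cong (_* ℕ→ℚ m) (1/n*n≡1 n) ⟨
    (1/n * ℕ→ℚ n) * ℕ→ℚ m ≡⟨ *-assoc 1/n (ℕ→ℚ n) (ℕ→ℚ m) ⟩
    1/n * (ℕ→ℚ n * ℕ→ℚ m) ≡⟨ cong (1/n *_) (*-comm (ℕ→ℚ n) (ℕ→ℚ m)) ⟩
    1/n * (ℕ→ℚ m * ℕ→ℚ n) ≡⟨ cong (1/n *_) (ℕ→ℚ-homo-* m n) ⟨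
    1/n * ℕ→ℚ (m ℕ.* n)   ≤⟨ *-monoˡ-≤-nonNeg 1/n {{normalize-nonNeg 1 n}} (ℕ→ℚ-mono-≤ m*n≤o) ⟩
    1/n * ℕ→ℚ o           ∎
    where
    open ≤-Reasoning
    1/n : ℚ
    1/n = (+ 1) / n

  sum≤ePartial*bound : ∀ n (a : Vector ℕ (suc n)) K → (∀ i → a i ℕ.* toℕ i ! ℕ.≤ K) →
    ℕ→ℚ (sum a) ≤ ePartial n * ℕ→ℚ K
  sum≤ePartial*bound zero a K bound rewrite ℕₚ.+-identityʳ (a Fin.zero) =
    m*n≤o⇒m≤1/n*o {a Fin.zero} 1 (bound Fin.zero)
  sum≤ePartial*bound (suc n) a K bound = begin
    ℕ→ℚ (sum a)                           ≡⟨ cong ℕ→ℚ (sum-init-last a) ⟩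
    ℕ→ℚ (sum (init a) ℕ.+ last a)         ≡⟨ ℕ→ℚ-homo-+ (sum (init a)) (last a) ⟩
    ℕ→ℚ (sum (init a)) + ℕ→ℚ (last a)     ≤⟨ +-mono-≤ (sum≤ePartial*bound n (init a) K init-bound)
                                                      (m*n≤o⇒m≤1/n*o {last a} (suc n !) {{suc n !≢0}} last-bound) ⟩
    ePartial n * ℕ→ℚ K + 1/[1+n]! * ℕ→ℚ K ≡⟨ *-distribʳ-+ (ℕ→ℚ K) (ePartial n) 1/[1+n]! ⟨
    ePartial (suc n) * ℕ→ℚ K              ∎
    where
    open ≤-Reasoning
    1/[1+n]! : ℚ
    1/[1+n]! = ((+ 1) / suc n !) {{suc n !≢0}}
    init-bound : ∀ i → init a i ℕ.* toℕ i ! ℕ.≤ K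
    init-bound i = subst (λ j → a (inject₁ i) ℕ.* j ! ℕ.≤ K) (toℕ-inject₁ i) (bound (inject₁ i))
    last-bound : last a ℕ.* suc n ! ℕ.≤ K
    last-bound = subst (λ j → last a ℕ.* j ! ℕ.≤ K) (toℕ-fromℕ (suc n)) (bound (fromℕ (suc n)))

  eLe⇒nonNeg : ∀ {q} → eLe q → NonNegative q
  eLe⇒nonNeg e≤q = nonNegative (≤-trans (nonNegative⁻¹ 1ℚ) (e≤q 0))

  [1+k]^k≤q*k^k : ∀ {q} → eLe q → ∀ k → ℕ→ℚ ((1 ℕ.+ k) ℕ.^ k) ≤ q * ℕ→ℚ (k ℕ.^ k)
  [1+k]^k≤q*k^k {q} e≤q k = begin
    ℕ→ℚ ((1 ℕ.+ k) ℕ.^ k)         ≡⟨ cong ℕ→ℚ ([1+k]^n≡∑nCi*k^[n∸i] k k) ⟩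
    ℕ→ℚ (sum binomialTerm)        ≤⟨ sum≤ePartial*bound k binomialTerm (k ℕ.^ k) (nCi*n^[n∸i]*i!≤n^n k ∘ toℕ) ⟩
    ePartial k * ℕ→ℚ (k ℕ.^ k)    ≤⟨ *-monoʳ-≤-nonNeg (ℕ→ℚ (k ℕ.^ k)) {{ℕ→ℚ-nonNeg (k ℕ.^ k)}} (e≤q k) ⟩
    q * ℕ→ℚ (k ℕ.^ k)             ∎
    where
    open ≤-Reasoning
    binomialTerm : Vector ℕ (suc k)
    binomialTerm i = (k C toℕ i) ℕ.* k ℕ.^ (k ℕ.∸ toℕ i)

  k^k≤k!*q^k : ∀ {q} → eLe q → ∀ k → ℕ→ℚ (k ℕ.^ k) ≤ ℕ→ℚ (k !) * (q ^ℚ k)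
  k^k≤k!*q^k e≤q zero        = ≤-refl
  k^k≤k!*q^k {q} e≤q (suc k) = begin
    ℕ→ℚ (suc k ℕ.* suc k ℕ.^ k)  ≡⟨ ℕ→ℚ-homo-* (suc k) (suc k ℕ.^ k) ⟩
    1+k * ℕ→ℚ (suc k ℕ.^ k)      ≤⟨ *-monoˡ-≤-nonNeg 1+k {{ℕ→ℚ-nonNeg (suc k)}} ([1+k]^k≤q*k^k e≤q k) ⟩
    1+k * (q * ℕ→ℚ (k ℕ.^ k))    ≤⟨ *-monoˡ-≤-nonNeg 1+k {{ℕ→ℚ-nonNeg (suc k)}}
                                      (*-monoˡ-≤-nonNeg q {{eLe⇒nonNeg e≤q}} (k^k≤k!*q^k e≤q k)) ⟩
    1+k * (q * (k! * q ^ℚ k))    ≡⟨ solve 4 (λ a q f r → a :* (q :* (f :* r)) := (a :* f) :* (q :* r))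
                                      refl 1+k q k! (q ^ℚ k) ⟩
    (1+k * k!) * (q * q ^ℚ k)    ≡⟨ cong (_* (q * q ^ℚ k)) (ℕ→ℚ-homo-* (suc k) (k !)) ⟨
    ℕ→ℚ (suc k !) * q ^ℚ suc k   ∎
    where
    open ≤-Reasoning
    1+k k! : ℚ
    1+k = ℕ→ℚ (suc k)
    k!  = ℕ→ℚ (k !)

  m*k!≤c*[t*k]^k⇒m≤c*q^k*t^k : ∀ {q} → eLe q → ∀ m c t k →
    m ℕ.* k ! ℕ.≤ c ℕ.* (t ℕ.* k) ℕ.^ k → ℕ→ℚ m ≤ (ℕ→ℚ c * q ^ℚ k) * ℕ→ℚ (t ℕ.^ k)
  m*k!≤c*[t*k]^k⇒m≤c*q^k*t^k {q} e≤q m c t k m*k!≤c*[t*k]^k =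
    *-cancelˡ-≤-pos k! {{normalize-pos (k !) 1 {{_}} {{k !≢0}}}} (begin
      k! * ℕ→ℚ m                          ≡⟨ *-comm k! (ℕ→ℚ m) ⟩
      ℕ→ℚ m * k!                          ≡⟨ ℕ→ℚ-homo-* m (k !) ⟨
      ℕ→ℚ (m ℕ.* k !)                     ≤⟨ ℕ→ℚ-mono-≤ m*k!≤c*[t*k]^k ⟩
      ℕ→ℚ (c ℕ.* (t ℕ.* k) ℕ.^ k)         ≡⟨ cong (λ x → ℕ→ℚ (c ℕ.* x)) (^-distribʳ-* t k k) ⟩
      ℕ→ℚ (c ℕ.* (t ℕ.^ k ℕ.* k ℕ.^ k))   ≡⟨ ℕ→ℚ-homo-* c _ ⟩
      ℕ→ℚ c * ℕ→ℚ (t ℕ.^ k ℕ.* k ℕ.^ k)   ≡⟨ cong (ℕ→ℚ c *_) (ℕ→ℚ-homo-* (t ℕ.^ k) (k ℕ.^ k)) ⟩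
      ℕ→ℚ c * (t^k * ℕ→ℚ (k ℕ.^ k))       ≤⟨ *-monoˡ-≤-nonNeg (ℕ→ℚ c) {{ℕ→ℚ-nonNeg c}}
                                               (*-monoˡ-≤-nonNeg t^k {{ℕ→ℚ-nonNeg (t ℕ.^ k)}} (k^k≤k!*q^k e≤q k)) ⟩
      ℕ→ℚ c * (t^k * (k! * q ^ℚ k))       ≡⟨ solve 4 (λ c t f r → c :* (t :* (f :* r)) := f :* ((c :* r) :* t))
                                               refl (ℕ→ℚ c) t^k k! (q ^ℚ k) ⟩
      k! * ((ℕ→ℚ c * q ^ℚ k) * t^k)       ∎)
    where
    open ≤-Reasoning
    k! t^k : ℚ
    k!  = ℕ→ℚ (k !)
    t^k = ℕ→ℚ (t ℕ.^ k)

open import Data.Nat using (ℕ; _<_; ⌊_/2⌋)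
import Data.Nat as ℕ
open import Data.Nat.Divisibility using (_∣_; divides)
open import Data.Nat.Properties using (⌊n/2⌋-mono; <⇒≤)
open import Data.Product using (Σ; _,_)
open import Data.Rational using (ℚ; _≤_; _*_)
open import Relation.Binary.PropositionalEquality using (subst)
open EulerBound using (m*k!≤c*[t*k]^k⇒m≤c*q^k*t^k)
open CyclicPolytope using (f0-cyclicDual*⌊d/2⌋!≤2*nEff^⌊d/2⌋; f0-Pstar≡t^⌊d/2⌋)

lemma3p2 : Σ ℕ λ C → ∀ (n d : ℕ) → 2 Data.Nat.≤ d → d < n → ⌊ d /2⌋ ∣ nEff n d →
    ∀ (q : ℚ) → eLe q →
    ℕ→ℚ (f0-cyclicDual n d) ≤ (ℕ→ℚ C * (q ^ℚ ⌊ d /2⌋)) * ℕ→ℚ (f0-Pstar n d)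
lemma3p2 = 2 , bound
  where
  bound : ∀ n d → 2 ℕ.≤ d → d < n → ⌊ d /2⌋ ∣ nEff n d → ∀ q → eLe q →
    ℕ→ℚ (f0-cyclicDual n d) ≤ (ℕ→ℚ 2 * (q ^ℚ ⌊ d /2⌋)) * ℕ→ℚ (f0-Pstar n d)
  bound n d 2≤d d<n (divides t nEff≡t*k) q e≤q
    rewrite f0-Pstar≡t^⌊d/2⌋ n d t (⌊n/2⌋-mono 2≤d) nEff≡t*k =
    m*k!≤c*[t*k]^k⇒m≤c*q^k*t^k e≤q (f0-cyclicDual n d) 2 t k f0*k!≤2*[t*k]^k
    where
    k : ℕ
    k = ⌊ d /2⌋
    f0*k!≤2*[t*k]^k : f0-cyclicDual n d ℕ.* k ℕ.! ℕ.≤ 2 ℕ.* (t ℕ.* k) ℕ.^ k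
    f0*k!≤2*[t*k]^k = subst (λ x → f0-cyclicDual n d ℕ.* k ℕ.! ℕ.≤ 2 ℕ.* x ℕ.^ k) nEff≡t*k
      (f0-cyclicDual*⌊d/2⌋!≤2*nEff^⌊d/2⌋ (<⇒≤ 2≤d) (<⇒≤ d<n))
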